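{- Let $\Delta$ be a finite simplicial complex with vertices in $\mathbb{N}$. If $\Delta$ is a shifted (respectively, compressed) complex, then so is $\mathrm{Inc}(\Delta)$.
   Context: $\mathbb{N}=\{1,2,\dots\}$; $d$-subsets are written $\mathbf{u}=(u_1,\dots,u_d)$ with $u_1<\dots<u_d$. A simplicial complex on $[m]=\{1,\dots,m\}$ is a collection of subsets of $[m]$ closed under taking subsets. $F_d(\Delta)$ is the set of faces of $\Delta$ with exactly $d$ elements. Squashed order: $\mathbf{u}<\mathbf{v}$ if the largest element of the symmetric difference lies in $\mathbf{v}$; a finite $\mathcal{F}\subseteq\binom{\mathbb{N}}{d}$ is compressed if it consists of the $|\mathcal{F}|$ smallest elements of $\binom{\mathbb{N}}{d}$. Borel order: $\mathbf{v}\le_B\mathbf{u}$ if $v_i\le u_i$ for all $i$; $\mathcal{F}$ is shifted if $\mathbf{v}\in\mathcal{F}$ whenever $\mathbf{v}\le_B\mathbf{u}$ for some $\mathbf{u}\in\mathcal{F}$. $\Delta$ is a shifted (resp. compressed) complex if $F_d(\Delta)$ is shifted (resp. compressed) for every $d\ge1$. $\mathrm{Inc}_1$ is the set of maps $\pi:\mathbb{N}\to\mathbb{N}$ with $\pi(j)<\pi(j+1)$, $\pi(j)\le j+1$ for all $j$, acting by $\pi(\mathbf{u})=(\pi(u_1),\dots,\pi(u_d))$; $\mathrm{Inc}(\mathcal{F})=\{\pi(\mathbf{u})\mid\mathbf{u}\in\mathcal{F},\pi\in\mathrm{Inc}_1\}$, and $\mathrm{Inc}(\Delta)=\bigcup_{d\ge1}\mathrm{Inc}(F_d(\Delta))$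 (a simplicial complex). -}

module Defs where

open import Data.Nat using (ℕ; suc; _≤_; _<_)
open import Data.List using (List; []; _∷_; length; map)
open import Data.List.Membership.Propositional using (_∈_; _∉_)
open import Data.List.Relation.Unary.All using (All)
open import Data.List.Relation.Unary.Linked using (Linked)
open import Data.List.Relation.Binary.Pointwise using (Pointwise)
open import Data.Product using (Σ; ∃; _×_)
open import Relation.Binary.PropositionalEquality using (_≡_)
open import Relation.Nullary using (¬_)
open import Function.Bundles using (_⇔_)

-- A finite subset of ℕ = {1,2,...} is represented canonically by the
-- strictly increasing list of its elements (all ≥ 1).
IsSet : List ℕ → Set
IsSet u = Linked _<_ u × All (1 ≤_) u

IsDSubset : ℕ → List ℕ → Set
IsDSubset d u = IsSet u × length u ≡ d

Family : Set₁
Family = List ℕ → Set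

IsSimplicialComplex : Family → Set
IsSimplicialComplex P =
  (∀ u → P u → IsSet u) ×
  (∀ u v → P u → IsSet v → All (_∈ u) v → P v)

_≤B_ : List ℕ → List ℕ → Set
v ≤B u = Pointwise _≤_ v u

_<sq_ : List ℕ → List ℕ → Set
u <sq v = ∃ λ x → x ∈ v × x ∉ u × (∀ y → x < y → (y ∈ u ⇔ y ∈ v))

ShiftedIn : ℕ → Family → Set
ShiftedIn d P = ∀ u v → IsDSubset d u → IsDSubset d v → v ≤B u → P u → P v

-- F_d(P) is compressed: finite and consists of the |F_d| smallest
-- d-subsets in squashed order, i.e. it is a finite initial segment.
CompressedIn : ℕ → Family → Set
CompressedIn d P =
  (∃ λ (L : List (List ℕ)) → ∀ u → IsDSubset d u → P u → u ∈ L) ×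
  (∀ u v → IsDSubset d u → IsDSubset d v → v <sq u → P u → P v)

Shifted : Family → Set
Shifted P = ∀ d → 1 ≤ d → ShiftedIn d P

Compressed : Family → Set
Compressed P = ∀ d → 1 ≤ d → CompressedIn d P

IsInc₁ : (ℕ → ℕ) → Set
IsInc₁ π = ∀ j → 1 ≤ j → (1 ≤ π j) × (π j < π (suc j)) × (π j ≤ suc j)

-- Inc(Δ) = ⋃_{d ≥ 1} Inc(F_d(Δ)) for a finite complex Δ given as the list
-- of its faces
Inc : List (List ℕ) → Family
Inc Δ v = ∃ λ u → u ∈ Δ × 1 ≤ length u ×
            (∃ λ π → IsInc₁ π × v ≡ map π u)

module Submission where

-- Faces are handled in decreasing order (reversed sets).  A map π ∈ Inc₁ moves
-- each point to itself or its successor.  Conversely every d-set v has a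
-- canonical preimage contract v: keep its maximal initial segment {1,…,k} and
-- lower every other element by one, so that v = shiftFrom (k+1) (contract v) with
-- shiftFrom (k+1) ∈ Inc₁.  The key fact is that contraction is monotone against
-- images: if u = π(w) and v lies below u in the Borel order (resp. in the
-- lexicographic order, which on decreasing lists is the squashed order), then
-- contract v lies below w in the same order.  So if Δ is shifted (compressed),
-- contract v ∈ Δ and v ∈ Inc(Δ).  Finiteness holds because every face of Inc(Δ)
-- is shiftFrom t of a face w of Δ with t ≤ |w| + 1.  The file develops decreasing
-- lists, contraction, Inc₁, the two orders, monotonicity, the finite enumeration,
-- and then the corollary.

open import Defs
open import Data.Nat using (ℕ; zero; suc; pred; _≤_; _<_; z≤n; s≤s; _≟_; _<?_)
open import Data.Nat.Properties
open import Data.List using (List; []; _∷_; length; map; reverse; _++_)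
open import Data.List.Properties using (length-map; length-reverse; reverse-map; reverse-involutive; unfold-reverse)
open import Data.List.Membership.Propositional using (_∈_; _∉_)
open import Data.List.Membership.Propositional.Properties using (∈-++⁺ˡ; ∈-++⁺ʳ)
open import Data.List.Relation.Unary.All as All using (All; []; _∷_)
open import Data.List.Relation.Unary.Any using (here; there)
open import Data.List.Relation.Unary.Any.Properties using () renaming (reverse⁺ to ∈-reverse⁺; reverse⁻ to ∈-reverse⁻)
open import Data.List.Relation.Unary.AllPairs using (AllPairs; []; _∷_)
import Data.List.Relation.Unary.AllPairs.Properties as AllPairs
open import Data.List.Relation.Unary.Linked.Properties using (Linked⇒AllPairs; AllPairs⇒Linked)
open import Data.List.Relation.Binary.Pointwise as Pointwise using (Pointwise; []; _∷_)
open import Data.Product using (_×_; _,_; proj₁; proj₂)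
open import Data.Sum using (_⊎_; inj₁; inj₂; [_,_])
open import Data.Empty using (⊥-elim)
open import Relation.Nullary using (yes; no)
open import Relation.Binary.Core using (Rel)
open import Relation.Binary.Definitions using (tri<; tri≈; tri>)
open import Relation.Binary.PropositionalEquality using (_≡_; _≢_; refl; sym; trans; cong; cong₂; subst; module ≡-Reasoning)
open import Function.Base using (flip)
open import Function.Bundles using (_⇔_; mk⇔; Equivalence)

open Equivalence using (to; from)

data Desc : List ℕ → Set where
  []   : Desc []
  cons : ∀ {a as} → All (_< a) as → 1 ≤ a → Desc as → Desc (a ∷ as)

length≤head : ∀ {a as} → Desc (a ∷ as) → suc (length as) ≤ a
length≤head (cons [] 1≤a _) = 1≤a
length≤head (cons (b<a ∷ _) _ d) = ≤-trans (s≤s (length≤head d)) b<a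

Desc-positive : ∀ {xs} → Desc xs → All (1 ≤_) xs
Desc-positive [] = []
Desc-positive (cons _ 1≤a d) = 1≤a ∷ Desc-positive d

∈⇒≤head : ∀ {a as y} → Desc (a ∷ as) → y ∈ a ∷ as → y ≤ a
∈⇒≤head _ (here refl) = ≤-refl
∈⇒≤head (cons below _ _) (there y∈as) = <⇒≤ (All.lookup below y∈as)

AllPairs-reverse : ∀ {a ℓ} {A : Set a} {R : Rel A ℓ} {xs} → AllPairs R xs → AllPairs (flip R) (reverse xs)
AllPairs-reverse [] = []
AllPairs-reverse {R = R} {x ∷ xs} (x-R ∷ pairs) =
  subst (AllPairs (flip R)) (sym (unfold-reverse x xs))
    (AllPairs.++⁺ (AllPairs-reverse pairs) ([] ∷ [])
      (All.tabulate (λ y∈ → All.lookup x-R (∈-reverse⁻ y∈) ∷ [])))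

All-reverse : ∀ {P : ℕ → Set} {xs} → All P xs → All P (reverse xs)
All-reverse all = All.tabulate (λ y∈ → All.lookup all (∈-reverse⁻ y∈))

Desc⇒AllPairs : ∀ {xs} → Desc xs → AllPairs (flip _<_) xs
Desc⇒AllPairs [] = []
Desc⇒AllPairs (cons below _ d) = below ∷ Desc⇒AllPairs d

AllPairs⇒Desc : ∀ {xs} → AllPairs (flip _<_) xs → All (1 ≤_) xs → Desc xs
AllPairs⇒Desc [] [] = []
AllPairs⇒Desc (below ∷ pairs) (1≤a ∷ pos) = cons below 1≤a (AllPairs⇒Desc pairs pos)

set⇒Desc : ∀ {u} → IsSet u → Desc (reverse u)
set⇒Desc (increasing , positive) =
  AllPairs⇒Desc (AllPairs-reverse (Linked⇒AllPairs <-trans increasing)) (All-reverse positive)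

Desc⇒set : ∀ {xs} → Desc xs → IsSet (reverse xs)
Desc⇒set d = AllPairs⇒Linked (AllPairs-reverse (Desc⇒AllPairs d)) , All-reverse (Desc-positive d)

down : ℕ → List ℕ
down zero = []
down (suc n) = suc n ∷ down n

full⇒down : ∀ {a as} → Desc (a ∷ as) → a ≡ suc (length as) → a ∷ as ≡ down (suc (length as))
full⇒down {as = []} _ a≡1 = cong (_∷ []) a≡1
full⇒down {as = b ∷ bs} (cons (b<a ∷ _) _ d) a≡len = cong₂ _∷_ a≡len (full⇒down d b≡len)
  where
  b≡len : b ≡ suc (length bs)
  b≡len = ≤-antisym (≤-pred (subst (b <_) a≡len b<a)) (length≤head d)

down-least : ∀ {ys} → Desc ys → Pointwise _≤_ (down (length ys)) ys
down-least [] = []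
down-least ys@(cons _ _ d) = length≤head ys ∷ down-least d

full-least : ∀ {a as ys} → Desc (a ∷ as) → a ≡ suc (length as) → Desc ys →
             suc (length as) ≡ length ys → Pointwise _≤_ (a ∷ as) ys
full-least {ys = ys} xs a≡len d len =
  subst (λ zs → Pointwise _≤_ zs ys) (sym (full⇒down xs a≡len))
    (subst (λ n → Pointwise _≤_ (down n) ys) (sym len) (down-least d))

contract : List ℕ → List ℕ
contract [] = []
contract (a ∷ as) with a ≟ suc (length as)
... | yes _ = a ∷ as
... | no _ = pred a ∷ contract as

-- threshold xs = k+1 for that maximal initial segment {1,…,k}.
threshold : List ℕ → ℕ
threshold [] = 1
threshold (a ∷ as) with a ≟ suc (length as)
... | yes _ = suc a
... | no _ = threshold as

shiftFrom : ℕ → ℕ → ℕ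
shiftFrom t j with j <? t
... | yes _ = j
... | no _ = suc j

shiftFrom-Inc₁ : ∀ t → IsInc₁ (shiftFrom t)
shiftFrom-Inc₁ t j 1≤j with j <? t | suc j <? t
... | yes _ | yes _ = 1≤j , n<1+n j , n≤1+n j
... | yes _ | no _ = 1≤j , <-trans (n<1+n j) (n<1+n (suc j)) , n≤1+n j
... | no j≮t | yes 1+j<t = ⊥-elim (j≮t (<-trans (n<1+n j) 1+j<t))
... | no _ | no _ = s≤s z≤n , n<1+n (suc j) , ≤-refl

shiftFrom-below : ∀ t xs → All (_< t) xs → map (shiftFrom t) xs ≡ xs
shiftFrom-below t [] [] = refl
shiftFrom-below t (x ∷ xs) (x<t ∷ below) with x <? t
... | yes _ = cong (x ∷_) (shiftFrom-below t xs below)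
... | no x≮t = ⊥-elim (x≮t x<t)

shiftFrom-above : ∀ {t j} → t ≤ j → shiftFrom t j ≡ suc j
shiftFrom-above {t} {j} t≤j with j <? t
... | yes j<t = ⊥-elim (<⇒≱ j<t t≤j)
... | no _ = refl

length-contract : ∀ xs → length (contract xs) ≡ length xs
length-contract [] = refl
length-contract (a ∷ as) with a ≟ suc (length as)
... | yes _ = refl
... | no _ = cong suc (length-contract as)

threshold≤1+length : ∀ xs → threshold xs ≤ suc (length xs)
threshold≤1+length [] = ≤-refl
threshold≤1+length (a ∷ as) with a ≟ suc (length as)
... | yes a≡len = s≤s (≤-reflexive a≡len)
... | no _ = m≤n⇒m≤1+n (threshold≤1+length as)

not-full⇒length<head : ∀ {a as} → Desc (a ∷ as) → a ≢ suc (length as) → suc (length as) < a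
not-full⇒length<head xs a≢len = ≤∧≢⇒< (length≤head xs) (λ len≡a → a≢len (sym len≡a))

shiftFrom-contract : ∀ {xs} → Desc xs → map (shiftFrom (threshold xs)) (contract xs) ≡ xs
shiftFrom-contract [] = refl
shiftFrom-contract {suc a ∷ as} xs@(cons below (s≤s z≤n) d) with suc a ≟ suc (length as)
... | yes _ = shiftFrom-below (suc (suc a)) (suc a ∷ as) (≤-refl ∷ All.map m<n⇒m<1+n below)
... | no a≢len = cong₂ _∷_ (shiftFrom-above threshold≤a) (shiftFrom-contract d)
  where
  threshold≤a : threshold as ≤ a
  threshold≤a = ≤-trans (threshold≤1+length as) (≤-pred (not-full⇒length<head xs a≢len))

contract-below : ∀ {as} → Desc as → ∀ a → All (_< a) as → suc (length as) < a →
                 All (_< pred a) (contract as)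
contract-below [] a _ _ = []
contract-below {suc b ∷ bs} (cons below (s≤s z≤n) d) a (b<a ∷ bs<a) len<a
  with suc b ≟ suc (length bs)
... | yes b≡len = 1+b<a-1 ∷ All.map (λ x<b → <-trans x<b 1+b<a-1) below
  where
  1+b<a-1 : suc b < pred a
  1+b<a-1 = suc[m]≤n⇒m≤pred[n] (subst (λ n → suc (suc n) ≤ a) (sym b≡len) len<a)
... | no _ = suc[m]≤n⇒m≤pred[n] b<a ∷ contract-below d a bs<a (<-trans (n<1+n _) len<a)

contract-Desc : ∀ {xs} → Desc xs → Desc (contract xs)
contract-Desc [] = []
contract-Desc {a ∷ as} xs@(cons below 1≤a d) with a ≟ suc (length as)
... | yes _ = xs
... | no a≢len =
  cons (contract-below d a below len<a) (≤-trans (s≤s z≤n) (suc[m]≤n⇒m≤pred[n] len<a)) (contract-Desc d)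
  where
  len<a : suc (length as) < a
  len<a = not-full⇒length<head xs a≢len

Near : ℕ → ℕ → Set
Near p b = b ≤ p × p ≤ suc b

-- Every π ∈ Inc₁ satisfies j ≤ π j (from π 1 ≥ 1 and strict increase), hence
-- π w is pointwise Near w.
Inc₁-increasing : ∀ {π} → IsInc₁ π → ∀ j → 1 ≤ j → j ≤ π j
Inc₁-increasing inc 1 _ = proj₁ (inc 1 (s≤s z≤n))
Inc₁-increasing inc (suc (suc k)) _ =
  ≤-trans (s≤s (Inc₁-increasing inc (suc k) (s≤s z≤n))) (proj₁ (proj₂ (inc (suc k) (s≤s z≤n))))

Inc₁-near : ∀ {π} → IsInc₁ π → ∀ {xs} → All (1 ≤_) xs → Pointwise Near (map π xs) xs
Inc₁-near inc [] = []
Inc₁-near inc {x ∷ _} (1≤x ∷ pos) = (Inc₁-increasing inc x 1≤x , proj₂ (proj₂ (inc x 1≤x))) ∷ Inc₁-near inc pos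

-- Non-strict lexicographic order on lists of equal length, read from the front;
-- on decreasing lists it is the squashed order (or equality).
data _≤lex_ : List ℕ → List ℕ → Set where
  []   : [] ≤lex []
  head : ∀ {a b as bs} → a < b → (a ∷ as) ≤lex (b ∷ bs)
  tail : ∀ {a as bs} → as ≤lex bs → (a ∷ as) ≤lex (a ∷ bs)

≤lex-refl : ∀ xs → xs ≤lex xs
≤lex-refl [] = []
≤lex-refl (x ∷ xs) = tail (≤lex-refl xs)

Borel⇒≤lex : ∀ {xs ys} → Pointwise _≤_ xs ys → xs ≤lex ys
Borel⇒≤lex [] = []
Borel⇒≤lex (x≤y ∷ rest) with m≤n⇒m<n∨m≡n x≤y
... | inj₁ x<y = head x<y
... | inj₂ refl = tail (Borel⇒≤lex rest)

<sq-resp-∈ : ∀ {X X′ Y Y′} → (∀ {y} → y ∈ X ⇔ y ∈ X′) → (∀ {y} → y ∈ Y ⇔ y ∈ Y′) →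
             X <sq Y → X′ <sq Y′
<sq-resp-∈ X≈X′ Y≈Y′ (z , z∈Y , z∉X , agree) =
  z , to Y≈Y′ z∈Y , (λ z∈X′ → z∉X (from X≈X′ z∈X′)) ,
  λ y z<y → mk⇔ (λ y∈X′ → to Y≈Y′ (to (agree y z<y) (from X≈X′ y∈X′)))
                (λ y∈Y′ → to X≈X′ (from (agree y z<y) (from Y≈Y′ y∈Y′)))

∈-reverse : ∀ {y : ℕ} {xs} → y ∈ xs ⇔ y ∈ reverse xs
∈-reverse = mk⇔ ∈-reverse⁺ ∈-reverse⁻

<sq-reverse : ∀ {X Y} → X <sq Y → reverse X <sq reverse Y
<sq-reverse = <sq-resp-∈ ∈-reverse ∈-reverse

∈-tail : ∀ {y a : ℕ} {xs} → y ≢ a → y ∈ a ∷ xs → y ∈ xs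
∈-tail y≢a (here y≡a) = ⊥-elim (y≢a y≡a)
∈-tail _ (there y∈xs) = y∈xs

agree-tail : ∀ {z a : ℕ} {as bs} → All (_< a) as → All (_< a) bs →
             (∀ y → z < y → (y ∈ a ∷ as ⇔ y ∈ a ∷ bs)) → (∀ y → z < y → (y ∈ as ⇔ y ∈ bs))
agree-tail as<a bs<a agree y z<y =
  mk⇔ (λ y∈as → ∈-tail (<⇒≢ (All.lookup as<a y∈as)) (to (agree y z<y) (there y∈as)))
      (λ y∈bs → ∈-tail (<⇒≢ (All.lookup bs<a y∈bs)) (from (agree y z<y) (there y∈bs)))

agree-cons : ∀ {z a : ℕ} {as bs} →
             (∀ y → z < y → (y ∈ as ⇔ y ∈ bs)) → (∀ y → z < y → (y ∈ a ∷ as ⇔ y ∈ a ∷ bs))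
agree-cons {a = a} {as} {bs} agree y z<y = mk⇔ forth back
  where
  forth : y ∈ a ∷ as → y ∈ a ∷ bs
  forth (here y≡a) = here y≡a
  forth (there y∈as) = there (to (agree y z<y) y∈as)
  back : y ∈ a ∷ bs → y ∈ a ∷ as
  back (here y≡a) = here y≡a
  back (there y∈bs) = there (from (agree y z<y) y∈bs)

≤lex⇒sq : ∀ {X Y} → Desc X → Desc Y → X ≤lex Y → X ≡ Y ⊎ X <sq Y
≤lex⇒sq _ _ [] = inj₁ refl
≤lex⇒sq X Y (head a<b) =
  inj₂ (_ , here refl , (λ b∈X → <⇒≱ a<b (∈⇒≤head X b∈X)) ,
        λ y b<y → mk⇔ (λ y∈X → ⊥-elim (<⇒≱ (<-trans a<b b<y) (∈⇒≤head X y∈X)))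
                      (λ y∈Y → ⊥-elim (<⇒≱ b<y (∈⇒≤head Y y∈Y))))
≤lex⇒sq {a ∷ as} (cons _ _ X) (cons bs<a _ Y) (tail as≤bs) with ≤lex⇒sq X Y as≤bs
... | inj₁ as≡bs = inj₁ (cong (a ∷_) as≡bs)
... | inj₂ (z , z∈bs , z∉as , agree) =
  inj₂ (z , there z∈bs , z∉a∷as , agree-cons agree)
  where
  z∉a∷as : z ∉ a ∷ as
  z∉a∷as (here z≡a) = <-irrefl z≡a (All.lookup bs<a z∈bs)
  z∉a∷as (there z∈as) = z∉as z∈as

sq⇒≤lex : ∀ {X Y} → Desc X → Desc Y → length X ≡ length Y → X <sq Y → X ≤lex Y
sq⇒≤lex {[]} {[]} _ _ _ _ = []
sq⇒≤lex {_ ∷ _} {[]} _ _ _ (_ , () , _)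
sq⇒≤lex {a ∷ as} {b ∷ bs} X Y len (z , z∈Y , z∉X , agree) with <-cmp a b
... | tri< a<b _ _ = head a<b
... | tri> _ _ b<a = ⊥-elim (<⇒≱ b<a (∈⇒≤head Y (to (agree a z<a) (here refl))))
  where
  z<a : z < a
  z<a = ≤-<-trans (∈⇒≤head Y z∈Y) b<a
sq⇒≤lex {a ∷ as} {.a ∷ bs} (cons as<a _ X) (cons bs<a _ Y) len (z , z∈Y , z∉X , agree)
  | tri≈ _ refl _ =
  tail (sq⇒≤lex X Y (suc-injective len)
         (z , ∈-tail (λ z≡a → z∉X (here z≡a)) z∈Y , (λ z∈as → z∉X (there z∈as)) ,
          agree-tail as<a bs<a agree))

contract-≤B : ∀ {v u w} → Desc v → Desc w → length v ≡ length w →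
              Pointwise _≤_ v u → Pointwise Near u w → Pointwise _≤_ (contract v) w
contract-≤B [] [] _ [] [] = []
contract-≤B {suc a ∷ as} v@(cons _ (s≤s z≤n) v′) w@(cons _ _ w′) len (a≤p ∷ v≤u) ((_ , p≤1+b) ∷ near)
  with suc a ≟ suc (length as)
... | yes full = full-least v full w len
... | no _ = ≤-pred (≤-trans a≤p p≤1+b) ∷ contract-≤B v′ w′ (suc-injective len) v≤u near

contract-≤lex : ∀ {v u w} → Desc v → Desc w → length v ≡ length w →
                v ≤lex u → Pointwise Near u w → contract v ≤lex w
contract-≤lex [] [] _ [] [] = []
contract-≤lex {suc a ∷ as} v@(cons _ (s≤s z≤n) _) w@(cons _ _ _) len _ (_ ∷ _)
  with suc a ≟ suc (length as)
... | yes full = Borel⇒≤lex (full-least v full w len)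
contract-≤lex _ _ _ (head a<p) ((_ , p≤1+b) ∷ _) | no _ = head (≤-pred (≤-trans a<p p≤1+b))
contract-≤lex {suc a ∷ _} (cons _ (s≤s z≤n) v′) (cons _ _ w′) len (tail as≤ps) ((_ , a≤1+b) ∷ near)
  | no _ with m≤n⇒m<n∨m≡n (≤-pred a≤1+b)
... | inj₁ a<b = head a<b
... | inj₂ refl = tail (contract-≤lex v′ w′ (suc-injective len) as≤ps near)

-- shiftImages w n lists the images shiftFrom t w for t < n; allShiftImages ws lists
-- them for every w ∈ ws and t ≤ |w| + 1, a finite list containing all of Inc(Δ).
shiftImages : List ℕ → ℕ → List (List ℕ)
shiftImages w zero = []
shiftImages w (suc n) = map (shiftFrom n) w ∷ shiftImages w n

allShiftImages : List (List ℕ) → List (List ℕ)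
allShiftImages [] = []
allShiftImages (w ∷ ws) = shiftImages w (suc (suc (length w))) ++ allShiftImages ws

∈-shiftImages : ∀ w {t n} → t < n → map (shiftFrom t) w ∈ shiftImages w n
∈-shiftImages w {t} {suc n} t<1+n with m≤n⇒m<n∨m≡n (≤-pred t<1+n)
... | inj₁ t<n = there (∈-shiftImages w t<n)
... | inj₂ refl = here refl

∈-allShiftImages : ∀ {ws w t} → w ∈ ws → t ≤ suc (length w) → map (shiftFrom t) w ∈ allShiftImages ws
∈-allShiftImages {w ∷ ws} (here refl) t≤ = ∈-++⁺ˡ (∈-shiftImages w (s≤s t≤))
∈-allShiftImages {w ∷ ws} (there w∈ws) t≤ = ∈-++⁺ʳ (shiftImages w _) (∈-allShiftImages w∈ws t≤)

canonical : List ℕ → List ℕ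
canonical v = reverse (contract (reverse v))

canonical-dsubset : ∀ {d v} → IsDSubset d v → IsDSubset d (canonical v)
canonical-dsubset {v = v} (v-set , len) =
  Desc⇒set (contract-Desc (set⇒Desc v-set)) ,
  trans (length-reverse (contract (reverse v)))
    (trans (length-contract (reverse v)) (trans (length-reverse v) len))

shift-canonical : ∀ {v} → IsSet v → map (shiftFrom (threshold (reverse v))) (canonical v) ≡ v
shift-canonical {v} v-set = begin
  map σ (reverse (contract (reverse v)))   ≡⟨ reverse-map σ (contract (reverse v)) ⟩
  reverse (map σ (contract (reverse v)))   ≡⟨ cong reverse (shiftFrom-contract (set⇒Desc v-set)) ⟩
  reverse (reverse v)                      ≡⟨ reverse-involutive v ⟩
  v                                        ∎
  where
  open ≡-Reasoning
  σ : ℕ → ℕ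
  σ = shiftFrom (threshold (reverse v))

length-reverse-≡ : ∀ {d v w} → IsDSubset d v → IsDSubset d w → length (reverse v) ≡ length (reverse w)
length-reverse-≡ {v = v} {w} (_ , v-len) (_ , w-len) =
  trans (length-reverse v) (trans v-len (sym (trans (length-reverse w) w-len)))

module _ (Δ : List (List ℕ)) (Δ-complex : IsSimplicialComplex (_∈ Δ)) where

  canonical∈⇒Inc : ∀ {d v} → 1 ≤ d → IsDSubset d v → canonical v ∈ Δ → Inc Δ v
  canonical∈⇒Inc {v = v} 1≤d v-dsub c∈Δ =
    canonical v , c∈Δ , subst (1 ≤_) (sym (proj₂ (canonical-dsubset v-dsub))) 1≤d ,
    shiftFrom (threshold (reverse v)) , shiftFrom-Inc₁ _ , sym (shift-canonical (proj₁ v-dsub))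

  record Preimage (d : ℕ) (u : List ℕ) : Set where
    field
      face : List ℕ
      face∈Δ : face ∈ Δ
      face-dsubset : IsDSubset d face
      near : Pointwise Near (reverse u) (reverse face)

  preimage : ∀ {d u} → IsDSubset d u → Inc Δ u → Preimage d u
  preimage {d} {u} (_ , u-len) (w , w∈Δ , _ , π , π-inc , u≡πw) = record
    { face = w ; face∈Δ = w∈Δ ; face-dsubset = w-dsub
    ; near = subst (λ z → Pointwise Near z (reverse w))
               (trans (reverse-map π w) (cong reverse (sym u≡πw)))
               (Inc₁-near π-inc (Desc-positive (set⇒Desc (proj₁ w-dsub)))) }
    where
    w-dsub : IsDSubset d w
    w-dsub = proj₁ Δ-complex w w∈Δ , trans (sym (length-map π w)) (trans (cong length (sym u≡πw)) u-len)

  -- Shifted case: the canonical preimage of v is Borel-below the preimage of u.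
  shifted-Inc : Shifted (_∈ Δ) → Shifted (Inc Δ)
  shifted-Inc Δ-shifted d 1≤d u v u-dsub v-dsub v≤u u∈Inc = canonical∈⇒Inc 1≤d v-dsub canonical∈Δ
    where
    open Preimage (preimage u-dsub u∈Inc)
    contract≤face : Pointwise _≤_ (contract (reverse v)) (reverse face)
    contract≤face =
      contract-≤B (set⇒Desc (proj₁ v-dsub)) (set⇒Desc (proj₁ face-dsubset))
        (length-reverse-≡ v-dsub face-dsubset) (Pointwise.reverse⁺ v≤u) near
    canonical≤face : Pointwise _≤_ (canonical v) face
    canonical≤face = subst (Pointwise _≤_ (canonical v)) (reverse-involutive face) (Pointwise.reverse⁺ contract≤face)
    canonical∈Δ : canonical v ∈ Δ
    canonical∈Δ = Δ-shifted d 1≤d face (canonical v) face-dsubset (canonical-dsubset v-dsub) canonical≤face face∈Δ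

  -- If Δ is compressed, the canonical preimage of anything lexicographically
  -- below a face of Inc(Δ) is a face of Δ: it equals or precedes the face's preimage.
  canonical-below : Compressed (_∈ Δ) → ∀ d → 1 ≤ d → ∀ {u v} → IsDSubset d u → IsDSubset d v →
                    reverse v ≤lex reverse u → Inc Δ u → canonical v ∈ Δ
  canonical-below Δ-compressed d 1≤d {u} {v} u-dsub v-dsub v≤u u∈Inc =
    [ equal , below ] (≤lex⇒sq (contract-Desc v-desc) face-desc
                        (contract-≤lex v-desc face-desc (length-reverse-≡ v-dsub face-dsubset) v≤u near))
    where
    open Preimage (preimage u-dsub u∈Inc)
    v-desc : Desc (reverse v)
    v-desc = set⇒Desc (proj₁ v-dsub)
    face-desc : Desc (reverse face)
    face-desc = set⇒Desc (proj₁ face-dsubset)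
    equal : contract (reverse v) ≡ reverse face → canonical v ∈ Δ
    equal c≡face = subst (_∈ Δ) (sym (trans (cong reverse c≡face) (reverse-involutive face))) face∈Δ
    below : contract (reverse v) <sq reverse face → canonical v ∈ Δ
    below c<face =
      proj₂ (Δ-compressed d 1≤d) face (canonical v) face-dsubset (canonical-dsubset v-dsub)
        (subst (canonical v <sq_) (reverse-involutive face) (<sq-reverse c<face)) face∈Δ

  -- Compressed case: closure under the squashed order via canonical-below; and
  -- finiteness, since each face is a shift of its canonical preimage in Δ by a
  -- threshold bounded by the size plus one.
  compressed-Inc : Compressed (_∈ Δ) → Compressed (Inc Δ)
  compressed-Inc Δ-compressed d 1≤d = (allShiftImages Δ , finite) , closed
    where
    closed : ∀ u v → IsDSubset d u → IsDSubset d v → v <sq u → Inc Δ u → Inc Δ v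
    closed u v u-dsub v-dsub v<u u∈Inc =
      canonical∈⇒Inc 1≤d v-dsub
        (canonical-below Δ-compressed d 1≤d u-dsub v-dsub
          (sq⇒≤lex (set⇒Desc (proj₁ v-dsub)) (set⇒Desc (proj₁ u-dsub)) (length-reverse-≡ v-dsub u-dsub)
            (<sq-reverse v<u))
          u∈Inc)
    finite : ∀ u → IsDSubset d u → Inc Δ u → u ∈ allShiftImages Δ
    finite u u-dsub u∈Inc =
      subst (_∈ allShiftImages Δ) (shift-canonical (proj₁ u-dsub))
        (∈-allShiftImages (canonical-below Δ-compressed d 1≤d u-dsub u-dsub (≤lex-refl _) u∈Inc) threshold-bound)
      where
      threshold-bound : threshold (reverse u) ≤ suc (length (canonical u))
      threshold-bound =
        subst (λ n → threshold (reverse u) ≤ suc n)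
          (sym (trans (length-reverse (contract (reverse u))) (length-contract (reverse u))))
          (threshold≤1+length (reverse u))

corollary4p1 : (Δ : List (List ℕ)) → IsSimplicialComplex (λ u → u ∈ Δ) →
    ((Shifted (λ u → u ∈ Δ) → Shifted (Inc Δ)) ×
    (Compressed (λ u → u ∈ Δ) → Compressed (Inc Δ)))
corollary4p1 Δ Δ-complex = shifted-Inc Δ Δ-complex , compressed-Inc Δ Δ-complex
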